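{- Let $(a_n)_{n\ge1}$ be defined by $a_1=1$ and $a_n=a_{n-1}+\operatorname{lcm}(n,a_{n-1})$ for $n\ge2$, and for $n\ge2$ let $b_n=\frac{n}{\gcd(n,a_{n-1})}$. For $m\ge1$ let $C_m=\prod_{q\le m,\ q\in\mathbb{P},\ q\ne 3}(q+1)$ (so $C_1=1$). For a prime $p$ and $m\ge1$ let $S^{(1)}_p(m)=\#\{q\le m:\ q\in\mathbb{P},\ q\ne 3,\ q\equiv -1 \pmod p\}$, and for $n\ge2$ let $\delta^{(1)}_p(n)=\max\{0,\ v_p(n)-S^{(1)}_p(n-1)\}$. Define $B^{(P)}_n=\frac{n}{\gcd(n,C_{n-1})}$ and $B^{(1)}_n=\prod_p p^{\delta^{(1)}_p(n)}$. Then for all $n\ge2$, \[ b_n\mid B^{(P)}_n\mid B^{(1)}_n . \]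
   Context: $\mathbb{P}$ denotes the set of primes and $v_p(n)$ the $p$-adic valuation of $n$. -}

module Defs where

open import Data.Nat using (ℕ; zero; suc; _+_; _*_; _∸_; _^_; NonZero)
open import Data.Nat.DivMod using (_/_)
open import Data.Nat.Divisibility using (_∣_; _∣?_; quotient)
open import Data.Nat.GCD using (gcd; gcd[m,n]∣m)
open import Data.Nat.LCM using (lcm)
open import Data.Nat.Primality using (prime?)
open import Data.Bool using (if_then_else_; _∧_; not)
open import Relation.Nullary using (does)
open import Data.Nat using (_≟_)

-- p-adic valuation v_p(n): the largest k with p^k ∣ n (for p ≥ 2, n ≥ 1).
-- Computed by repeated division; `fuel` bounds the number of divisions
-- (fuel = n suffices since p^k ≤ n). Convention: v p 0 = 0, v p n = 0 for p ≤ 1.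
valAux : ℕ → ℕ → ℕ → ℕ
valAux zero          p             n = 0
valAux (suc fuel)    zero          n = 0
valAux (suc fuel)    (suc zero)    n = 0
valAux (suc fuel)    (suc (suc k)) zero = 0
valAux (suc fuel)    (suc (suc k)) (suc m) =
  if does (suc (suc k) ∣? suc m)
  then suc (valAux fuel (suc (suc k)) (suc m / suc (suc k)))
  else 0

v : ℕ → ℕ → ℕ
v p n = valAux n p n

-- the sequence a_n (a 0 is an unused junk value)
a : ℕ → ℕ
a zero = 0
a (suc zero) = 1
a (suc (suc n)) = a (suc n) + lcm (suc (suc n)) (a (suc n))

_div_by_ : (n d : ℕ) → d ∣ n → ℕ
n div d by p = quotient p

b : ℕ → ℕ
b n = n div gcd n (a (n ∸ 1)) by gcd[m,n]∣m n (a (n ∸ 1))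

primeNot3 : ℕ → Data.Bool.Bool
primeNot3 q = does (prime? q) ∧ not (does (q ≟ 3))

C : ℕ → ℕ
C zero = 1
C (suc m) = (if primeNot3 (suc m) then suc m + 1 else 1) * C m

-- S^(1)_p(m) = #{ q ≤ m : q prime, q ≠ 3, q ≡ -1 (mod p) }
-- (q ≡ -1 mod p  ⇔  p ∣ q + 1)
S1 : ℕ → ℕ → ℕ
S1 p zero = 0
S1 p (suc m) =
  (if primeNot3 (suc m) ∧ does (p ∣? (suc m + 1)) then 1 else 0) + S1 p m

-- δ^(1)_p(n) = max{0, v_p(n) − S^(1)_p(n−1)}  (truncated subtraction)
δ1 : ℕ → ℕ → ℕ
δ1 p n = v p n ∸ S1 p (n ∸ 1)

BP : ℕ → ℕ
BP n = n div gcd n (C (n ∸ 1)) by gcd[m,n]∣m n (C (n ∸ 1))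

prodδ : ℕ → ℕ → ℕ
prodδ n zero = 1
prodδ n (suc k) = (if does (prime? (suc k)) then suc k ^ δ1 (suc k) n else 1) * prodδ n k

-- B^(1)_n = ∏_p p^{δ^(1)_p(n)}; factors with p > n are 1 since v_p(n) = 0.
B1 : ℕ → ℕ
B1 n = prodδ n n

-- Since lcm(n, a_{n-1}) = b_n a_{n-1}, the recursion reads a_n = (1 + b_n) a_{n-1}, with b_n ≤ n.
-- A prime p ≠ 3 therefore never divides a_{p-1}: a prime p > k dividing 1 + b_k forces
-- p = k + 1 and gcd(k, a_{k-1}) = 1, impossible for p ≥ 5 since then k and a_{k-1} are both even.
-- So gcd(p, a_{p-1}) = 1 and a_p = (p + 1) a_{p-1} for every prime p ≠ 3, whence C_m ∣ a_m,
-- gcd(n, C_{n-1}) ∣ gcd(n, a_{n-1}) and b_n ∣ B^(P)_n.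
-- For the second divisibility, p^{S_p(n-1)} ∣ C_{n-1}, so gcd(n, C_{n-1}) removes at least
-- min(v_p(n), S_p(n-1)) factors p from n, i.e. v_p(B^(P)_n) ≤ δ_p(n); a number whose prime
-- factors are all ≤ n and obey these bounds divides ∏_{p ≤ n} p^{δ_p(n)}.
module Submission where

open import Data.Bool using (true; false; if_then_else_; _∧_; not)
open import Data.List using ([]; _∷_)
open import Data.List.Relation.Unary.All using (_∷_)
open import Data.Nat
open import Data.Nat.Divisibility
open import Data.Nat.DivMod using (_/_; m*[n/m]≡n; m/n<m; m≥n⇒m/n>0)
open import Data.Nat.GCD using (gcd; gcd[m,n]∣m; gcd[m,n]∣n; gcd-greatest; gcd[m,n]≢0)
open import Data.Nat.LCM using (lcm; gcd*lcm; n∣lcm[m,n])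
open import Data.Nat.ListAction using (product)
open import Data.Nat.Primality
open import Data.Nat.Primality.Factorisation using (factorise)
open import Data.Nat.Properties
open import Data.Product using (∃-syntax; _×_; _,_; uncurry)
open import Data.Sum using (_⊎_; inj₁; inj₂; [_,_]′)
open import Relation.Nullary using (Dec; yes; no; does; contradiction)
open import Relation.Binary.PropositionalEquality

open import Defs

^-monoʳ-∣ : ∀ p {m n} → m ≤ n → p ^ m ∣ p ^ n
^-monoʳ-∣ p {m} {n} m≤n = begin
  p ^ m               ∣⟨ m∣m*n (p ^ (n ∸ m)) ⟩
  p ^ m * p ^ (n ∸ m) ≡⟨ ^-distribˡ-+-* p m (n ∸ m) ⟨
  p ^ (m + (n ∸ m))   ≡⟨ cong (p ^_) (m+[n∸m]≡n m≤n) ⟩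
  p ^ n               ∎
  where open ∣-Reasoning

quotient-∣-quotient : ∀ {d e n} .{{_ : NonZero d}} (d∣e : d ∣ e) (d∣n : d ∣ n) (e∣n : e ∣ n) →
                      quotient e∣n ∣ quotient d∣n
quotient-∣-quotient {d} {e} {n} d∣e d∣n e∣n = divides (quotient d∣e) (*-cancelʳ-≡ _ _ d (begin
  quotient d∣n * d                   ≡⟨ m∣n⇒n≡quotient*m d∣n ⟨
  n                                  ≡⟨ m∣n⇒n≡quotient*m e∣n ⟩
  quotient e∣n * e                   ≡⟨ cong (quotient e∣n *_) (m∣n⇒n≡quotient*m d∣e) ⟩
  quotient e∣n * (quotient d∣e * d)  ≡⟨ *-assoc (quotient e∣n) _ d ⟨
  quotient e∣n * quotient d∣e * d    ≡⟨ cong (_* d) (*-comm (quotient e∣n) _) ⟩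
  quotient d∣e * quotient e∣n * d    ∎))
  where open ≡-Reasoning

quotient≡n⇒≡1 : ∀ {d n} .{{_ : NonZero n}} (d∣n : d ∣ n) → quotient d∣n ≡ n → d ≡ 1
quotient≡n⇒≡1 {d} {n} d∣n q≡n = *-cancelˡ-≡ d 1 n (begin
  n * d            ≡⟨ cong (_* d) q≡n ⟨
  quotient d∣n * d ≡⟨ m∣n⇒n≡quotient*m d∣n ⟨
  n                ≡⟨ *-identityʳ n ⟨
  n * 1            ∎)
  where open ≡-Reasoning

≡1⇒quotient≡n : ∀ {d n} (d∣n : d ∣ n) → d ≡ 1 → quotient d∣n ≡ n
≡1⇒quotient≡n {d} {n} d∣n d≡1 = sym (begin
  n                ≡⟨ m∣n⇒n≡quotient*m d∣n ⟩
  quotient d∣n * d ≡⟨ cong (quotient d∣n *_) d≡1 ⟩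
  quotient d∣n * 1 ≡⟨ *-identityʳ _ ⟩
  quotient d∣n     ∎)
  where open ≡-Reasoning

2∣n⊎2∣1+n : ∀ n → 2 ∣ n ⊎ 2 ∣ suc n
2∣n⊎2∣1+n zero = inj₁ (2 ∣0)
2∣n⊎2∣1+n (suc n) with 2∣n⊎2∣1+n n
... | inj₁ 2∣n   = inj₂ (∣m∣n⇒∣m+n ∣-refl 2∣n)
... | inj₂ 2∣1+n = inj₁ 2∣1+n

gcd-nonZeroˡ : ∀ m n .{{_ : NonZero m}} → NonZero (gcd m n)
gcd-nonZeroˡ m n = ≢-nonZero (gcd[m,n]≢0 m n (inj₁ (≢-nonZero⁻¹ m)))

lcm≡quotient*n : ∀ m n .{{_ : NonZero m}} → lcm m n ≡ quotient (gcd[m,n]∣m m n) * n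
lcm≡quotient*n m n = *-cancelˡ-≡ _ _ g {{gcd-nonZeroˡ m n}} (begin
  g * lcm m n  ≡⟨ gcd*lcm m n ⟩
  m * n        ≡⟨ cong (_* n) (m∣n⇒n≡m*quotient (gcd[m,n]∣m m n)) ⟩
  g * q * n    ≡⟨ *-assoc g q n ⟩
  g * (q * n)  ∎)
  where
  open ≡-Reasoning
  g = gcd m n
  q = quotient (gcd[m,n]∣m m n)

2∣m∧2∣n⇒gcd≢1 : ∀ {m n} → 2 ∣ m → 2 ∣ n → gcd m n ≢ 1
2∣m∧2∣n⇒gcd≢1 2∣m 2∣n gcd≡1 with ∣1⇒≡1 (subst (2 ∣_) gcd≡1 (gcd-greatest 2∣m 2∣n))
... | ()

prime⇒≥2 : ∀ {p} → Prime p → 2 ≤ p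
prime⇒≥2 {p} p-prime = nonTrivial⇒n>1 p {{prime⇒nonTrivial p-prime}}

prime∧2∣⇒≡2 : ∀ {p} → Prime p → 2 ∣ p → p ≡ 2
prime∧2∣⇒≡2 p-prime 2∣p with prime⇒irreducible p-prime 2∣p
... | inj₂ 2≡p = sym 2≡p

prime∤⇒gcd≡1 : ∀ {p n} → Prime p → p ∤ n → gcd p n ≡ 1
prime∤⇒gcd≡1 {p} {n} p-prime p∤n with prime⇒irreducible p-prime (gcd[m,n]∣m p n)
... | inj₁ g≡1 = g≡1
... | inj₂ g≡p = contradiction (subst (_∣ n) g≡p (gcd[m,n]∣n p n)) p∤n

≢1⇒∃prime∣ : ∀ {x} .{{_ : NonZero x}} → x ≢ 1 → ∃[ q ] Prime q × q ∣ x
≢1⇒∃prime∣ {x} x≢1 with factorise x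
... | record { factors = [] ; isFactorisation = x≡1 } = contradiction x≡1 x≢1
... | record { factors = q ∷ qs ; isFactorisation = x≡∏ ; factorsPrime = q-prime ∷ _ } =
  q , q-prime , subst (q ∣_) (sym x≡∏) (m∣m*n (product qs))

p^valAux∣ : ∀ fuel p n → p ^ valAux fuel p n ∣ n
p^valAux∣ zero                 p n       = 1∣ n
p^valAux∣ (suc fuel)           0 n       = 1∣ n
p^valAux∣ (suc fuel)           1 n       = 1∣ n
p^valAux∣ (suc fuel) (suc (suc k)) zero  = 1∣ 0
p^valAux∣ (suc fuel) p@(suc (suc k)) n@(suc m) = step (p ∣? n)
  where
  step : (p∣?n : Dec (p ∣ n)) → p ^ (if does p∣?n then suc (valAux fuel p (n / p)) else 0) ∣ n
  step (no  _)   = 1∣ n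
  step (yes p∣n) = begin
    p * p ^ valAux fuel p (n / p) ∣⟨ *-monoʳ-∣ p (p^valAux∣ fuel p (n / p)) ⟩
    p * (n / p)                   ≡⟨ m*[n/m]≡n p∣n ⟩
    n                             ∎
    where open ∣-Reasoning

p^suc[valAux]∤ : ∀ fuel {p} n .{{_ : NonZero n}} → 2 ≤ p → n ≤ fuel → p ^ suc (valAux fuel p n) ∤ n
p^suc[valAux]∤ (suc fuel) {p@(suc (suc _))} n@(suc m) (s≤s (s≤s _)) (s≤s n≤1+fuel) = step (p ∣? n)
  where
  step : (p∣?n : Dec (p ∣ n)) → p ^ suc (if does p∣?n then suc (valAux fuel p (n / p)) else 0) ∤ n
  step (no  p∤n) p∣n = p∤n (subst (_∣ n) (*-identityʳ p) p∣n)
  step (yes p∣n) p^∣n = p^suc[valAux]∤ fuel (n / p) {{>-nonZero (m≥n⇒m/n>0 (∣⇒≤ p∣n))}} (s≤s (s≤s z≤n))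
    (≤-trans (<⇒≤pred (m/n<m n p (s≤s (s≤s z≤n)))) n≤1+fuel)
    (*-cancelˡ-∣ p (subst (p * p ^ suc (valAux fuel p (n / p)) ∣_) (sym (m*[n/m]≡n p∣n)) p^∣n))

p^v∣ : ∀ p n → p ^ v p n ∣ n
p^v∣ p n = p^valAux∣ n p n

p^suc[v]∤ : ∀ {p} n .{{_ : NonZero n}} → 2 ≤ p → p ^ suc (v p n) ∤ n
p^suc[v]∤ n 2≤p = p^suc[valAux]∤ n n 2≤p ≤-refl

primePowerFactor : (ℕ → ℕ) → ℕ → ℕ
primePowerFactor e p = if does (prime? p) then p ^ e p else 1

primePowerProduct : (ℕ → ℕ) → ℕ → ℕ
primePowerProduct e zero    = 1
primePowerProduct e (suc k) = primePowerFactor e (suc k) * primePowerProduct e k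

prodδ≡primePowerProduct : ∀ n k → prodδ n k ≡ primePowerProduct (λ p → δ1 p n) k
prodδ≡primePowerProduct n zero    = refl
prodδ≡primePowerProduct n (suc k) = cong (primePowerFactor (λ p → δ1 p n) (suc k) *_) (prodδ≡primePowerProduct n k)

∣primePowerProduct : ∀ e k x .{{_ : NonZero x}} →
                     (∀ q → Prime q → q ∣ x → q ≤ k) →
                     (∀ p → Prime p → p ≤ k → p ^ suc (e p) ∤ x) →
                     x ∣ primePowerProduct e k
∣primePowerProduct e zero x primes≤0 _ with x ≟ 1
... | yes refl = ∣-refl
... | no  x≢1 with ≢1⇒∃prime∣ x≢1
...   | q , q-prime , q∣x = contradiction (subst Prime (n≤0⇒n≡0 (primes≤0 q q-prime q∣x)) q-prime) ¬prime[0]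
∣primePowerProduct e (suc k) x primes≤ bounds with prime? (suc k)
... | no ¬P-prime = ∣n⇒∣m*n 1 (∣primePowerProduct e k x primes≤k bounds≤k)
  where
  primes≤k : ∀ q → Prime q → q ∣ x → q ≤ k
  primes≤k q q-prime q∣x = ≤-pred (≤∧≢⇒< (primes≤ q q-prime q∣x) λ { refl → ¬P-prime q-prime })
  bounds≤k : ∀ p → Prime p → p ≤ k → p ^ suc (e p) ∤ x
  bounds≤k p p-prime p≤k = bounds p p-prime (m≤n⇒m≤1+n p≤k)
... | yes P-prime = begin
  x                               ≡⟨ m∣n⇒n≡m*quotient P^v∣x ⟩
  P ^ v P x * x′                  ∣⟨ *-pres-∣ (^-monoʳ-∣ P v≤e) (∣primePowerProduct e k x′ {{x′≢0}} primes≤k bounds≤k) ⟩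
  P ^ e P * primePowerProduct e k ∎
  where
  open ∣-Reasoning
  P = suc k
  P^v∣x = p^v∣ P x
  x′ = quotient P^v∣x
  x′≢0 = quotient≢0 P^v∣x
  x′∣x = quotient-∣ P^v∣x
  v≤e : v P x ≤ e P
  v≤e = ≮⇒≥ λ e<v → bounds P P-prime ≤-refl (∣-trans (^-monoʳ-∣ P e<v) P^v∣x)
  P∤x′ : P ∤ x′
  P∤x′ P∣x′ = p^suc[v]∤ x (prime⇒≥2 P-prime) (begin
    P * P ^ v P x  ≡⟨ *-comm P _ ⟩
    P ^ v P x * P  ∣⟨ *-monoʳ-∣ (P ^ v P x) P∣x′ ⟩
    P ^ v P x * x′ ≡⟨ m∣n⇒n≡m*quotient P^v∣x ⟨
    x              ∎)
  primes≤k : ∀ q → Prime q → q ∣ x′ → q ≤ k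
  primes≤k q q-prime q∣x′ = ≤-pred (≤∧≢⇒< (primes≤ q q-prime (∣-trans q∣x′ x′∣x)) λ { refl → P∤x′ q∣x′ })
  bounds≤k : ∀ p → Prime p → p ≤ k → p ^ suc (e p) ∤ x′
  bounds≤k p p-prime p≤k p^∣x′ = bounds p p-prime (m≤n⇒m≤1+n p≤k) (∣-trans p^∣x′ x′∣x)

a[1+j]∣a[2+j] : ∀ j → a (suc j) ∣ a (suc (suc j))
a[1+j]∣a[2+j] j = ∣m∣n⇒∣m+n ∣-refl (n∣lcm[m,n] (suc (suc j)) (a (suc j)))

2∣a[3+i] : ∀ i → 2 ∣ a (3 + i)
2∣a[3+i] zero    = divides 3 refl
2∣a[3+i] (suc i) = ∣-trans (2∣a[3+i] i) (a[1+j]∣a[2+j] (2 + i))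

a[2+j]≡[1+b[2+j]]*a[1+j] : ∀ j → a (2 + j) ≡ suc (b (2 + j)) * a (1 + j)
a[2+j]≡[1+b[2+j]]*a[1+j] j = cong (a (1 + j) +_) (lcm≡quotient*n (2 + j) (a (1 + j)))

b≤n : ∀ n .{{_ : NonZero n}} → b n ≤ n
b≤n n = ∣⇒≤ (quotient-∣ (gcd[m,n]∣m n (a (n ∸ 1))))

∣1+b⇒≡1+n∧gcd≡1 : ∀ {p} n .{{_ : NonZero n}} → n < p → p ∣ suc (b n) → p ≡ suc n × gcd n (a (n ∸ 1)) ≡ 1
∣1+b⇒≡1+n∧gcd≡1 {p} n n<p p∣1+b = p≡1+n , quotient≡n⇒≡1 (gcd[m,n]∣m n (a (n ∸ 1))) b≡n
  where
  b≡n : b n ≡ n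
  b≡n = ≤-antisym (b≤n n) (≤-pred (≤-trans n<p (∣⇒≤ p∣1+b)))
  p≡1+n : p ≡ suc n
  p≡1+n = ≤-antisym (subst (λ m → p ≤ suc m) b≡n (∣⇒≤ p∣1+b)) n<p

2∣[2+j]∧2∣a[1+j] : ∀ j → Prime (3 + j) → 3 + j ≢ 3 → 2 ∣ 2 + j × 2 ∣ a (1 + j)
2∣[2+j]∧2∣a[1+j] zero          _       3≢3 = contradiction refl 3≢3
2∣[2+j]∧2∣a[1+j] (suc zero)    4-prime _   = contradiction (prime∧2∣⇒≡2 4-prime (divides 2 refl)) λ ()
2∣[2+j]∧2∣a[1+j] (suc (suc i)) p-prime _   = [ (λ 2∣4+i → 2∣4+i , 2∣a[3+i] i)
                                             , (λ 2∣5+i → contradiction (prime∧2∣⇒≡2 p-prime 2∣5+i) λ ()) ]′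
                                             (2∣n⊎2∣1+n (4 + i))

prime∤a : ∀ {p} → Prime p → p ≢ 3 → ∀ j → suc j < p → p ∤ a (suc j)
prime∤a p-prime _ zero _ p∣1 = ¬prime[1] (subst Prime (∣1⇒≡1 p∣1) p-prime)
prime∤a {p} p-prime p≢3 (suc j) 2+j<p p∣a[2+j]
  with euclidsLemma (suc (b (2 + j))) (a (1 + j)) p-prime (subst (p ∣_) (a[2+j]≡[1+b[2+j]]*a[1+j] j) p∣a[2+j])
... | inj₂ p∣a[1+j] = prime∤a p-prime p≢3 j (<-trans (n<1+n (suc j)) 2+j<p) p∣a[1+j]
... | inj₁ p∣1+b with ∣1+b⇒≡1+n∧gcd≡1 (2 + j) 2+j<p p∣1+b
...   | refl , gcd≡1 = uncurry 2∣m∧2∣n⇒gcd≢1 (2∣[2+j]∧2∣a[1+j] j p-prime p≢3) gcd≡1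

a[p]≡[p+1]*a[p-1] : ∀ j → Prime (2 + j) → 2 + j ≢ 3 → a (2 + j) ≡ (2 + j + 1) * a (1 + j)
a[p]≡[p+1]*a[p-1] j p-prime p≢3 = begin
  a (2 + j)                   ≡⟨ a[2+j]≡[1+b[2+j]]*a[1+j] j ⟩
  suc (b (2 + j)) * a (1 + j) ≡⟨ cong (λ m → suc m * a (1 + j)) b≡p ⟩
  suc (2 + j) * a (1 + j)     ≡⟨ cong (_* a (1 + j)) (+-comm 1 (2 + j)) ⟩
  (2 + j + 1) * a (1 + j)     ∎
  where
  open ≡-Reasoning
  b≡p : b (2 + j) ≡ 2 + j
  b≡p = ≡1⇒quotient≡n (gcd[m,n]∣m (2 + j) (a (1 + j)))
          (prime∤⇒gcd≡1 p-prime (prime∤a p-prime p≢3 j ≤-refl))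

C∣a-step : ∀ j → C (1 + j) ∣ a (1 + j) → C (2 + j) ∣ a (2 + j)
C∣a-step j C∣a[1+j] = step (prime? (2 + j)) (2 + j ≟ 3)
  where
  C[1+j]∣a[2+j] : 1 * C (1 + j) ∣ a (2 + j)
  C[1+j]∣a[2+j] = subst (_∣ a (2 + j)) (sym (*-identityˡ _)) (∣-trans C∣a[1+j] (a[1+j]∣a[2+j] j))
  step : (p? : Dec (Prime (2 + j))) (≟3 : Dec (2 + j ≡ 3)) →
         (if does p? ∧ not (does ≟3) then 2 + j + 1 else 1) * C (1 + j) ∣ a (2 + j)
  step (no  _)       _         = C[1+j]∣a[2+j]
  step (yes _)       (yes _)   = C[1+j]∣a[2+j]
  step (yes p-prime) (no  p≢3) = subst ((2 + j + 1) * C (1 + j) ∣_) (sym (a[p]≡[p+1]*a[p-1] j p-prime p≢3))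
                                   (*-monoʳ-∣ (2 + j + 1) C∣a[1+j])

C∣a : ∀ m → C m ∣ a m
C∣a zero          = 1∣ 0
C∣a (suc zero)    = ∣-refl
C∣a (suc (suc j)) = C∣a-step j (C∣a (suc j))

b∣BP : ∀ n .{{_ : NonZero n}} → b n ∣ BP n
b∣BP n = quotient-∣-quotient {{gcd-nonZeroˡ n (C (n ∸ 1))}}
  (gcd-greatest (gcd[m,n]∣m n (C (n ∸ 1))) (∣-trans (gcd[m,n]∣n n (C (n ∸ 1))) (C∣a (n ∸ 1))))
  (gcd[m,n]∣m n (C (n ∸ 1))) (gcd[m,n]∣m n (a (n ∸ 1)))

p^S1∣C : ∀ p m → p ^ S1 p m ∣ C m
p^S1∣C p zero    = ∣-refl
p^S1∣C p (suc m) = step (primeNot3 (suc m)) (p ∣? suc m + 1)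
  where
  step : ∀ counted (p∣?q+1 : Dec (p ∣ suc m + 1)) →
         p ^ ((if counted ∧ does p∣?q+1 then 1 else 0) + S1 p m) ∣ (if counted then suc m + 1 else 1) * C m
  step false _         = ∣n⇒∣m*n 1 (p^S1∣C p m)
  step true  (no  _)   = ∣n⇒∣m*n (suc m + 1) (p^S1∣C p m)
  step true  (yes p∣q) = *-pres-∣ p∣q (p^S1∣C p m)

p^suc[δ1]∤BP : ∀ {p} n .{{_ : NonZero n}} → 2 ≤ p → p ^ suc (δ1 p n) ∤ BP n
p^suc[δ1]∤BP {p} n 2≤p p^∣BP = p^suc[v]∤ n 2≤p (begin
  p ^ suc (v p n)                ≡⟨ cong (λ i → p ^ suc i) (m⊓n+n∸m≡n s (v p n)) ⟨
  p ^ suc (t + δ1 p n)           ≡⟨ cong (p ^_) (+-suc t (δ1 p n)) ⟨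
  p ^ (t + suc (δ1 p n))         ≡⟨ ^-distribˡ-+-* p t (suc (δ1 p n)) ⟩
  p ^ t * p ^ suc (δ1 p n)       ∣⟨ *-pres-∣ p^t∣g p^∣BP ⟩
  gcd n (C (n ∸ 1)) * BP n       ≡⟨ m∣n⇒n≡m*quotient (gcd[m,n]∣m n (C (n ∸ 1))) ⟨
  n                              ∎)
  where
  open ∣-Reasoning
  s = S1 p (n ∸ 1)
  t = s ⊓ v p n
  p^t∣g : p ^ t ∣ gcd n (C (n ∸ 1))
  p^t∣g = gcd-greatest (∣-trans (^-monoʳ-∣ p (m⊓n≤n s (v p n))) (p^v∣ p n))
                       (∣-trans (^-monoʳ-∣ p (m⊓n≤m s (v p n))) (p^S1∣C p (n ∸ 1)))

BP∣B1 : ∀ n .{{_ : NonZero n}} → BP n ∣ B1 n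
BP∣B1 n = subst (BP n ∣_) (sym (prodδ≡primePowerProduct n n))
  (∣primePowerProduct (λ p → δ1 p n) n (BP n) {{quotient≢0 (gcd[m,n]∣m n (C (n ∸ 1)))}}
    (λ q _ q∣BP → ∣⇒≤ (∣-trans q∣BP (quotient-∣ (gcd[m,n]∣m n (C (n ∸ 1))))))
    (λ p p-prime _ → p^suc[δ1]∤BP n (prime⇒≥2 p-prime)))

lemma4p8 : (n : ℕ) → 2 ≤ n → (b n ∣ BP n) × (BP n ∣ B1 n)
lemma4p8 n 2≤n = b∣BP n , BP∣B1 n
  where instance _ = >-nonZero (≤-trans (s≤s z≤n) 2≤n)
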